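{- For every variable $x$ and term $t$, the following are equivalent: (1) $\mathsf{LANG} \models x \le t$; (2) $\hat{\mathfrak{v}}(x) \subseteq \hat{\mathfrak{v}}(t)$ for all language valuations $\mathfrak{v}$ over the set $\{\ell\}$ such that $\mathfrak{v}(y) \subseteq \{\mathrm{I}, \ell\}$ for all variables $y$; (3) $\hat{\mathfrak{v}}^{w}(x) \subseteq \hat{\mathfrak{v}}^{w}(t)$ for all language valuations $\mathfrak{v}$ (over any set $X$) and all words $w$ over $X$.
   Context: Let $\mathbf{V}$ be a set of variables. Terms are generated by $t, s ::= x \mid \mathrm{I} \mid \bot \mid t \cdot s \mid t \cup s \mid t^{*} \mid x^{ - }$ ($x \in \mathbf{V}$). For a set $X$, a language valuation over $X$ is a map $\mathfrak{v}$ from variables to subsets of $X^{*}$ ($\mathrm{I}$ = empty word), extended to terms $\hat{\mathfrak{v}}$ by $\hat{\mathfrak{v}}(\mathrm{I}) = \{\mathrm{I}\}$, $\hat{\mathfrak{v}}(\bot) = \emptyset$, $\hat{\mathfrak{v}}(t\cdot s) = \{ab \mid a \in \hat{\mathfrak{v}}(t), b \in \hat{\mathfrak{v}}(s)\}$, $\hat{\mathfrak{v}}(t \cup s) = \hat{\mathfrak{v}}(t)\cup\hat{\mathfrak{v}}(s)$, $\hat{\mathfrak{v}}(t^{*}) = \hat{\mathfrak{v}}(t)^{*}$, $\hat{\mathfrak{v}}(x^{ - }) = X^{*} \setminus \mathfrak{v}(x)$. $\mathsf{LANG} \models t \le s$ means $\hat{\mathfrak{v}}(t) \subseteq \hat{\mathfrak{v}}(s)$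 for all language valuations over all sets. For a language valuation $\mathfrak{v}$ over $X$ and a word $w$ over $X$, $\mathfrak{v}^{w}$ is the language valuation over the one-letter set $\{\ell\}$ given by $\mathfrak{v}^{w}(y) = \{\mathrm{I} \mid \mathrm{I} \in \mathfrak{v}(y)\} \cup \{\ell \mid w \in \mathfrak{v}(y)\}$. -}

module Defs where

open import Data.List using (List; []; _∷_; _++_; length)
open import Data.Nat using (_≤_)
open import Data.Product using (Σ; _×_; ∃)
open import Data.Unit using (⊤; tt)
open import Data.Empty using (⊥)
open import Relation.Nullary using (¬_)
open import Relation.Binary.PropositionalEquality using (_≡_)

data Term (V : Set) : Set where
  var  : V → Term V
  𝕀    : Term V
  𝟘    : Term V
  _·_  : Term V → Term V → Term V
  _∪_  : Term V → Term V → Term V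
  _*   : Term V → Term V
  _⁻   : V → Term V

Lang : Set → Set₁
Lang X = List X → Set

data Star {X : Set} (L : Lang X) : Lang X where
  nil  : Star L []
  cons : ∀ {a b} → L a → Star L b → Star L (a ++ b)

Valuation : Set → Set → Set₁
Valuation V X = V → Lang X

⟦_⟧ : {V X : Set} → Term V → Valuation V X → Lang X
⟦ var x ⟧ v w = v x w
⟦ 𝕀 ⟧ v w = w ≡ []
⟦ 𝟘 ⟧ v w = ⊥
⟦ t · s ⟧ v w = Σ _ λ a → Σ _ λ b → (w ≡ a ++ b) × ⟦ t ⟧ v a × ⟦ s ⟧ v b
⟦ t ∪ s ⟧ v w = Data.Sum._⊎_ (⟦ t ⟧ v w) (⟦ s ⟧ v w)
  where import Data.Sum
⟦ t * ⟧ v w = Star (⟦ t ⟧ v) w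
⟦ x ⁻ ⟧ v w = ¬ (v x w)

_⊆_ : {X : Set} → Lang X → Lang X → Set
L ⊆ K = ∀ w → L w → K w

LANG⊨_≤_ : {V : Set} → Term V → Term V → Set₁
LANG⊨_≤_ {V} t s = (X : Set) (v : Valuation V X) → ⟦ t ⟧ v ⊆ ⟦ s ⟧ v

ℓ : ⊤
ℓ = tt

-- v^w : the valuation over {ℓ} with
-- v^w(y) = {I | I ∈ v(y)} ∪ {ℓ | w ∈ v(y)}.
_^_ : {V X : Set} → Valuation V X → List X → Valuation V ⊤
(v ^ w) y []          = v y []
(v ^ w) y (_ ∷ [])    = v y w
(v ^ w) y (_ ∷ _ ∷ _) = ⊥

{-# OPTIONS --safe #-}
module Submission where

-- Evaluating a term under v ^ w at the word ℓ reflects its evaluation under v at w, and at the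
-- empty word reflects it at the empty word (induction on the term; complements go through
-- because v ^ w agrees with v exactly on these two words, and a factorisation of a word of
-- length ≤ 1 has an empty factor). Since the variable x takes the same value under both, an
-- inclusion x ≤ t refuted by v at w is refuted by v ^ w at ℓ, and v ^ w only uses words of
-- length ≤ 1.

open import Defs
open import Data.List using (List; length; []; _∷_; [_])
open import Data.List.Properties using (++-identityʳ)
open import Data.Nat using (_≤_; z≤n; s≤s)
open import Data.Product using (_×_; _,_)
open import Data.Sum using (inj₁; inj₂)
open import Data.Unit using (⊤)
open import Function using (_∘_)
open import Function.Bundles using (_⇔_; mk⇔)
open import Relation.Binary.PropositionalEquality using (_≡_; refl; sym; subst)

star-[_] : {X : Set} {L : Lang X} (u : List X) → L u → Star L u
star-[ u ] p = subst (Star _) (++-identityʳ u) (cons p nil)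

star-[_]⁻¹ : {X : Set} {L : Lang X} (a : X) → Star L [ a ] → L [ a ]
star-[ a ]⁻¹ s = go s refl
  where
  go : ∀ {L u} → Star L u → u ≡ [ a ] → L [ a ]
  go (cons {[]}          p s) eq   = go s eq
  go (cons {_ ∷ []} {[]} p s) refl = p

module _ {V X : Set} (v : Valuation V X) (w : List X) where

  ^-reflects-[] : (t : Term V) → ⟦ t ⟧ (v ^ w) [] → ⟦ t ⟧ v []
  ^-reflects-[] (var y) p = p
  ^-reflects-[] 𝕀 p = refl
  ^-reflects-[] (t · s) ([] , [] , refl , p , q) =
    [] , [] , refl , ^-reflects-[] t p , ^-reflects-[] s q
  ^-reflects-[] (t ∪ s) (inj₁ p) = inj₁ (^-reflects-[] t p)
  ^-reflects-[] (t ∪ s) (inj₂ p) = inj₂ (^-reflects-[] s p)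
  ^-reflects-[] (t *) p = nil
  ^-reflects-[] (y ⁻) p = p

  ^-reflects-[ℓ] : (t : Term V) → ⟦ t ⟧ (v ^ w) [ ℓ ] → ⟦ t ⟧ v w
  ^-reflects-[ℓ] (var y) p = p
  ^-reflects-[ℓ] (t · s) ([] , _ ∷ [] , refl , p , q) =
    [] , w , refl , ^-reflects-[] t p , ^-reflects-[ℓ] s q
  ^-reflects-[ℓ] (t · s) (_ ∷ [] , [] , refl , p , q) =
    w , [] , sym (++-identityʳ w) , ^-reflects-[ℓ] t p , ^-reflects-[] s q
  ^-reflects-[ℓ] (t ∪ s) (inj₁ p) = inj₁ (^-reflects-[ℓ] t p)
  ^-reflects-[ℓ] (t ∪ s) (inj₂ p) = inj₂ (^-reflects-[ℓ] s p)
  ^-reflects-[ℓ] (t *) p = star-[ w ] (^-reflects-[ℓ] t (star-[ ℓ ]⁻¹ p))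
  ^-reflects-[ℓ] (y ⁻) p = p

  ^-length≤1 : ∀ y u → (v ^ w) y u → length u ≤ 1
  ^-length≤1 y []      p = z≤n
  ^-length≤1 y (_ ∷ []) p = s≤s z≤n

theorem4p5 : {V : Set} (x : V) (t : Term V) →
    ((LANG⊨ var x ≤ t)
      ⇔ ((v : Valuation V ⊤) → (∀ y w → v y w → length w ≤ 1) → ⟦ var x ⟧ v ⊆ ⟦ t ⟧ v))
    × ((LANG⊨ var x ≤ t)
      ⇔ ((X : Set) (v : Valuation V X) (w : List X) → ⟦ var x ⟧ (v ^ w) ⊆ ⟦ t ⟧ (v ^ w)))
theorem4p5 {V} x t = mk⇔ valid⇒bounded (^⇒valid ∘ bounded⇒^) , mk⇔ valid⇒^ ^⇒valid
  where
  Bounded ^-Valid : Set₁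
  Bounded = (v : Valuation V ⊤) → (∀ y w → v y w → length w ≤ 1) → ⟦ var x ⟧ v ⊆ ⟦ t ⟧ v
  ^-Valid = (X : Set) (v : Valuation V X) (w : List X) → ⟦ var x ⟧ (v ^ w) ⊆ ⟦ t ⟧ (v ^ w)

  valid⇒bounded : LANG⊨ var x ≤ t → Bounded
  valid⇒bounded h v _ = h ⊤ v

  valid⇒^ : LANG⊨ var x ≤ t → ^-Valid
  valid⇒^ h X v w = h ⊤ (v ^ w)

  bounded⇒^ : Bounded → ^-Valid
  bounded⇒^ h X v w = h (v ^ w) (^-length≤1 v w)

  ^⇒valid : ^-Valid → LANG⊨ var x ≤ t
  ^⇒valid h X v w p = ^-reflects-[ℓ] v w t (h X v w [ ℓ ] p)
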